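{- Let $G$ be a simple connected graph with $n$ vertices $v_1,\dots,v_n$ and $m$ edges. Let $t\ge 0$ and $r\ge 3$ be integers. Let $G_C$ be the graph obtained from $G$ by attaching, to each vertex $v_i$, $t$ copies of the cycle $C_r$ of length $r$, where $v_i$ is identified with one vertex of each such cycle, and distinct attached cycles are otherwise vertex-disjoint from each other and from $G$. Then $$HM(G_C)=HM(G)+10t\,M_1(G)+32mt^2+16mt+8nt^3+16nt^2+(16r-24)nt.$$
   Context: For a graph $H$, the hyper Zagreb index is $HM(H)=\sum_{uv\in E(H)}\left[d_H(u)+d_H(v)\right]^2$ and the first Zagreb index is $M_1(H)=\sum_{v\in V(H)}d_H(v)^2$, where $d_H(x)$ is the degree of $x$ in $H$. -}

module Defs where

open import Data.Bool using (Bool; true; false; _∧_; _∨_)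
open import Data.Nat using (ℕ; zero; suc; _+_; _*_; _∸_; _^_)
import Data.Nat as ℕ
open import Data.Fin using (Fin; toℕ)
import Data.Fin as Fin
open import Data.List using (List; []; _∷_; map; _++_; filterᵇ; length; allFin; cartesianProduct)
open import Data.Nat.ListAction using (sum)
open import Data.Product using (_×_; _,_)
open import Data.Sum using (_⊎_; inj₁; inj₂)
open import Relation.Binary.PropositionalEquality using (_≡_)
open import Relation.Nullary.Decidable using (⌊_⌋)

-- A finite graph is given by an enumeration `vs` of its vertex set
-- (a duplicate-free list) and a Boolean adjacency relation `adj`,
-- assumed symmetric and irreflexive (simple graph).

deg : {V : Set} → List V → (V → V → Bool) → V → ℕ
deg vs adj v = length (filterᵇ (adj v) vs)

pairs : {V : Set} → List V → List (V × V)
pairs []       = []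
pairs (x ∷ xs) = map (x ,_) xs ++ pairs xs

edges : {V : Set} → List V → (V → V → Bool) → List (V × V)
edges vs adj = filterᵇ (λ { (u , v) → adj u v }) (pairs vs)

numEdges : {V : Set} → List V → (V → V → Bool) → ℕ
numEdges vs adj = length (edges vs adj)

M1 : {V : Set} → List V → (V → V → Bool) → ℕ
M1 vs adj = sum (map (λ v → deg vs adj v ^ 2) vs)

HM : {V : Set} → List V → (V → V → Bool) → ℕ
HM vs adj = sum (map (λ { (u , v) → (deg vs adj u + deg vs adj v) ^ 2 }) (edges vs adj))

Adj : ℕ → Set
Adj n = Fin n → Fin n → Bool

Symmetric : {n : ℕ} → Adj n → Set
Symmetric adj = ∀ u v → adj u v ≡ adj v u

Irreflexive : {n : ℕ} → Adj n → Set
Irreflexive adj = ∀ u → adj u u ≡ false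

data Reach {n : ℕ} (adj : Adj n) : Fin n → Fin n → Set where
  here : ∀ {u} → Reach adj u u
  step : ∀ {u w v} → adj u w ≡ true → Reach adj w v → Reach adj u v

Connected : {n : ℕ} → Adj n → Set
Connected adj = ∀ u v → Reach adj u v

-- Vertices: the original vertices (inj₁ a) together with,
-- for each vertex a, each copy j < t and each k < r - 1, a new vertex
-- inj₂ (a , j , k).  The j-th cycle at a is
--   a — (a,j,0) — (a,j,1) — … — (a,j,r-2) — a ,
-- a cycle of length r (for r ≥ 3).

VC : ℕ → ℕ → ℕ → Set
VC n t r = Fin n ⊎ (Fin n × Fin t × Fin (r ∸ 1))

vsC : (n t r : ℕ) → List (VC n t r)
vsC n t r = map inj₁ (allFin n)
         ++ map inj₂ (cartesianProduct (allFin n) (cartesianProduct (allFin t) (allFin (r ∸ 1))))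

-- is the cycle vertex with index k adjacent to its base vertex?
endIdx : {s : ℕ} → (r : ℕ) → Fin s → Bool
endIdx r k = ⌊ toℕ k ℕ.≟ 0 ⌋ ∨ ⌊ toℕ k ℕ.≟ (r ∸ 2) ⌋

adjC : {n : ℕ} → Adj n → (t r : ℕ) → VC n t r → VC n t r → Bool
adjC adj t r (inj₁ a) (inj₁ b) = adj a b
adjC adj t r (inj₁ a) (inj₂ (b , j , k)) = ⌊ a Fin.≟ b ⌋ ∧ endIdx r k
adjC adj t r (inj₂ (b , j , k)) (inj₁ a) = ⌊ a Fin.≟ b ⌋ ∧ endIdx r k
adjC adj t r (inj₂ (a , j , k)) (inj₂ (b , j' , k')) =
  ⌊ a Fin.≟ b ⌋ ∧ ⌊ j Fin.≟ j' ⌋ ∧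
  (⌊ toℕ k' ℕ.≟ suc (toℕ k) ⌋ ∨ ⌊ toℕ k ℕ.≟ suc (toℕ k') ⌋)

module Submission where

-- Counting every edge from both ends, 2·HM(H) = Σ_u Σ_{v ~ u} (d u + d v)², while
-- Σ_u Σ_{v ~ u} 1 = 2|E(H)| and Σ_u Σ_{v ~ u} (d u + d v) = 2·M₁(H).  In G_C a vertex a of G has
-- degree d a + 2t and every cycle vertex has degree 2.  So the ordered pairs of adjacent vertices of
-- G_C are: those inside G, contributing (d a + d b + 4t)²; the 2t pairs joining a to its cycle
-- neighbours, in both directions, contributing (d a + 2t + 2)²; and the 2(r − 2) ordered pairs inside
-- each of the nt cycle paths, contributing 16.  Expanding the squares leaves HM(G), M₁(G), m and n.

open import Defs
open import Data.Bool using (Bool; true; false; _∧_; _∨_)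
open import Data.Bool.Properties using (∨-comm; ∧-zeroʳ)
open import Data.Fin using (Fin; toℕ)
import Data.Fin as Fin
open import Data.List using (List; []; _∷_; map; _++_; filterᵇ; length; allFin; tabulate; cartesianProduct)
open import Data.List.Properties using (map-++; map-∘; map-tabulate)
open import Data.Nat using (ℕ; zero; suc; _+_; _*_; _∸_; _^_; _≤_; _<_; _<?_; s≤s)
open import Data.Fin.Properties using (toℕ<n)
import Data.Nat as ℕ
open import Data.Nat.ListAction using (sum)
open import Data.Nat.ListAction.Properties using (sum-++)
open import Data.Nat.Properties
open import Data.Nat.Tactic.RingSolver using (solve-∀)
open import Data.Nat.Solver using (module +-*-Solver)
open +-*-Solver using (solve; _:+_; _:*_; _:^_; _:=_; con)
open import Data.Product using (_×_; _,_; uncurry)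
open import Data.Sum using (inj₁; inj₂)
open import Function using (_∘_)
open import Relation.Binary.Definitions using (DecidableEquality)
open import Relation.Binary.PropositionalEquality using (_≡_; refl; sym; trans; cong; cong₂; module ≡-Reasoning)
open import Relation.Nullary using (¬_; Dec; yes; no; contradiction)
open import Relation.Nullary.Decidable using (⌊_⌋; ⌊⌋-map′; does; isYes≗does)

private
  variable
    A B : Set

χ : Bool → ℕ
χ true  = 1
χ false = 0

∑ : List A → (A → ℕ) → ℕ
∑ xs f = sum (map f xs)

infix 5 ∑
syntax ∑ xs (λ x → e) = ∑[ x ∈ xs ] e

∑-cong : (xs : List A) {f g : A → ℕ} → (∀ x → f x ≡ g x) → ∑ xs f ≡ ∑ xs g
∑-cong []       f≗g = refl
∑-cong (x ∷ xs) f≗g = cong₂ _+_ (f≗g x) (∑-cong xs f≗g)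

∑-++ : (xs ys : List A) (f : A → ℕ) → ∑ (xs ++ ys) f ≡ ∑ xs f + ∑ ys f
∑-++ xs ys f = trans (cong sum (map-++ f xs ys)) (sum-++ (map f xs) (map f ys))

∑-map : (g : B → A) (xs : List B) (f : A → ℕ) → ∑ (map g xs) f ≡ ∑[ x ∈ xs ] f (g x)
∑-map g xs f = cong sum (sym (map-∘ xs))

∑-linear : (xs : List A) (a b c : ℕ) (f g h : A → ℕ) →
           ∑[ x ∈ xs ] (a * f x + b * g x + c * h x) ≡ a * ∑ xs f + b * ∑ xs g + c * ∑ xs h
∑-linear []       a b c f g h = zero-combination a b c
  where
    zero-combination : ∀ a b c → 0 ≡ a * 0 + b * 0 + c * 0
    zero-combination = solve-∀
∑-linear (x ∷ xs) a b c f g h =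
  trans (cong (a * f x + b * g x + c * h x +_) (∑-linear xs a b c f g h))
        (interchange a b c (f x) (g x) (h x) (∑ xs f) (∑ xs g) (∑ xs h))
  where
    interchange : ∀ a b c u v w U V W →
                  a * u + b * v + c * w + (a * U + b * V + c * W)
                  ≡ a * (u + U) + b * (v + V) + c * (w + W)
    interchange = solve-∀

∑-zero : (xs : List A) → ∑[ x ∈ xs ] 0 ≡ 0
∑-zero []       = refl
∑-zero (x ∷ xs) = ∑-zero xs

*-distribˡ-∑ : (c : ℕ) (xs : List A) (f : A → ℕ) → c * ∑ xs f ≡ ∑[ x ∈ xs ] c * f x
*-distribˡ-∑ c []       f = *-zeroʳ c
*-distribˡ-∑ c (x ∷ xs) f = trans (*-distribˡ-+ c (f x) (∑ xs f)) (cong (c * f x +_) (*-distribˡ-∑ c xs f))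

*-distribʳ-∑ : (c : ℕ) (xs : List A) (f : A → ℕ) → ∑ xs f * c ≡ ∑[ x ∈ xs ] f x * c
*-distribʳ-∑ c []       f = refl
*-distribʳ-∑ c (x ∷ xs) f = trans (*-distribʳ-+ c (f x) (∑ xs f)) (cong (f x * c +_) (*-distribʳ-∑ c xs f))

∑-distrib-+ : (xs : List A) (f g : A → ℕ) → ∑[ x ∈ xs ] (f x + g x) ≡ ∑ xs f + ∑ xs g
∑-distrib-+ []       f g = refl
∑-distrib-+ (x ∷ xs) f g =
  trans (cong (f x + g x +_) (∑-distrib-+ xs f g)) (+-+-comm (f x) (g x) (∑ xs f) (∑ xs g))
  where
    +-+-comm : ∀ a b c d → a + b + (c + d) ≡ a + c + (b + d)
    +-+-comm = solve-∀

∑-comm : (xs : List A) (ys : List B) (f : A → B → ℕ) →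
         ∑[ x ∈ xs ] ∑[ y ∈ ys ] f x y ≡ ∑[ y ∈ ys ] ∑[ x ∈ xs ] f x y
∑-comm []       ys f = sym (∑-zero ys)
∑-comm (x ∷ xs) ys f =
  trans (cong (∑ ys (f x) +_) (∑-comm xs ys f)) (sym (∑-distrib-+ ys (f x) (λ y → ∑[ x ∈ xs ] f x y)))

∑-cartesianProduct : (xs : List A) (ys : List B) (f : A × B → ℕ) →
                     ∑ (cartesianProduct xs ys) f ≡ ∑[ x ∈ xs ] ∑[ y ∈ ys ] f (x , y)
∑-cartesianProduct []       ys f = refl
∑-cartesianProduct (x ∷ xs) ys f =
  trans (∑-++ (map (x ,_) ys) _ f) (cong₂ _+_ (∑-map (x ,_) ys f) (∑-cartesianProduct xs ys f))

∑-allFin-suc : (n : ℕ) (f : Fin (suc n) → ℕ) → ∑ (allFin (suc n)) f ≡ f Fin.zero + (∑[ i ∈ allFin n ] f (Fin.suc i))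
∑-allFin-suc n f = cong (λ l → f Fin.zero + sum l) (trans (map-tabulate Fin.suc f) (sym (map-tabulate (λ i → i) (f ∘ Fin.suc))))

∑-allFin-const : (m c : ℕ) → ∑[ i ∈ allFin m ] c ≡ m * c
∑-allFin-const zero    c = refl
∑-allFin-const (suc m) c = trans (∑-allFin-suc m (λ _ → c)) (cong (c +_) (∑-allFin-const m c))

∑-filterᵇ : (p : A → Bool) (xs : List A) (f : A → ℕ) → ∑ (filterᵇ p xs) f ≡ ∑[ x ∈ xs ] χ (p x) * f x
∑-filterᵇ p []       f = refl
∑-filterᵇ p (x ∷ xs) f with p x
... | true  = cong₂ _+_ (sym (+-identityʳ (f x))) (∑-filterᵇ p xs f)
... | false = ∑-filterᵇ p xs f

length≡∑-1 : (xs : List A) → length xs ≡ ∑[ x ∈ xs ] 1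
length≡∑-1 []       = refl
length≡∑-1 (x ∷ xs) = cong suc (length≡∑-1 xs)

⌊⌋-yes : {P : Set} (P? : Dec P) → P → ⌊ P? ⌋ ≡ true
⌊⌋-yes (yes _) _ = refl
⌊⌋-yes (no ¬p) p = contradiction p ¬p

⌊⌋-no : {P : Set} (P? : Dec P) → ¬ P → ⌊ P? ⌋ ≡ false
⌊⌋-no (yes p) ¬p = contradiction p ¬p
⌊⌋-no (no _)  _  = refl

-- Unlike `⌊_⌋`, `does` of ℕ's `_≟_` and `_<?_` computes under `suc`, so the equations fed to this
-- lemma below are `refl`.
⌊⌋-via-does : {P Q : Set} (P? : Dec P) (Q? : Dec Q) → does P? ≡ does Q? → ⌊ P? ⌋ ≡ ⌊ Q? ⌋
⌊⌋-via-does P? Q? eq = trans (isYes≗does P?) (trans eq (sym (isYes≗does Q?)))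

χ-∧ : (p q : Bool) (x : ℕ) → χ (p ∧ q) * x ≡ χ p * (χ q * x)
χ-∧ true  q x = sym (+-identityʳ (χ q * x))
χ-∧ false q x = refl

∑-χ-∧ : (q : Bool) (xs : List A) (p : A → Bool) (f : A → ℕ) →
        ∑[ x ∈ xs ] χ (q ∧ p x) * f x ≡ χ q * (∑[ x ∈ xs ] χ (p x) * f x)
∑-χ-∧ q xs p f = trans (∑-cong xs (λ x → χ-∧ q (p x) (f x))) (sym (*-distribˡ-∑ (χ q) xs (λ x → χ (p x) * f x)))

≟-sym : (_≟_ : DecidableEquality A) (x y : A) → ⌊ x ≟ y ⌋ ≡ ⌊ y ≟ x ⌋
≟-sym _≟_ x y with x ≟ y | y ≟ x
... | yes _   | yes _   = refl
... | no _    | no _    = refl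
... | yes x≡y | no y≢x = contradiction (sym x≡y) y≢x
... | no x≢y  | yes y≡x = contradiction (sym y≡x) x≢y

∑-δ : ∀ {n} (a : Fin n) (f : Fin n → ℕ) → ∑[ b ∈ allFin n ] χ ⌊ a Fin.≟ b ⌋ * f b ≡ f a
∑-δ {suc n} Fin.zero f =
  trans (∑-allFin-suc n (λ b → χ ⌊ Fin.zero Fin.≟ b ⌋ * f b))
        (trans (cong₂ _+_ (+-identityʳ (f Fin.zero)) (∑-zero (allFin n))) (+-identityʳ (f Fin.zero)))
∑-δ {suc n} (Fin.suc a) f =
  trans (∑-allFin-suc n (λ b → χ ⌊ Fin.suc a Fin.≟ b ⌋ * f b))
        (trans (∑-cong (allFin n) (λ b → cong (λ e → χ e * f (Fin.suc b)) (⌊⌋-map′ _ _ (a Fin.≟ b))))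
               (∑-δ a (f ∘ Fin.suc)))

∑-δ-outer : ∀ {n} (a : Fin n) (xs : List A) (f : Fin n → A → ℕ) →
            ∑[ b ∈ allFin n ] ∑[ x ∈ xs ] χ ⌊ a Fin.≟ b ⌋ * f b x ≡ ∑[ x ∈ xs ] f a x
∑-δ-outer a xs f = trans (∑-cong (allFin _) (λ b → sym (*-distribˡ-∑ (χ ⌊ a Fin.≟ b ⌋) xs (f b))))
                         (∑-δ a (λ b → ∑ xs (f b)))

∑-pairs : (xs : List A) (g : A → A → ℕ) → (∀ x y → g x y ≡ g y x) →
          2 * ∑ (pairs xs) (uncurry g) + (∑[ x ∈ xs ] g x x) ≡ ∑[ x ∈ xs ] ∑[ y ∈ xs ] g x y
∑-pairs []       g g-sym = refl
∑-pairs (x ∷ xs) g g-sym = begin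
  2 * ∑ (map (x ,_) xs ++ pairs xs) (uncurry g) + (g x x + (∑[ y ∈ xs ] g y y))
    ≡⟨ cong (λ s → 2 * s + (g x x + (∑[ y ∈ xs ] g y y)))
            (trans (∑-++ (map (x ,_) xs) (pairs xs) (uncurry g)) (cong (_+ P) (∑-map (x ,_) xs (uncurry g)))) ⟩
  2 * (R + P) + (g x x + D)
    ≡⟨ regroup (g x x) R P D ⟩
  g x x + R + (R + (2 * P + D))
    ≡⟨ cong₂ (λ l r → g x x + R + (l + r)) (∑-cong xs (g-sym x)) (∑-pairs xs g g-sym) ⟩
  g x x + R + ((∑[ y ∈ xs ] g y x) + (∑[ y ∈ xs ] ∑[ z ∈ xs ] g y z))
    ≡⟨ cong (g x x + R +_) (sym (∑-distrib-+ xs (λ y → g y x) (λ y → ∑[ z ∈ xs ] g y z))) ⟩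
  ∑[ y ∈ x ∷ xs ] ∑[ z ∈ x ∷ xs ] g y z ∎
  where
    open ≡-Reasoning
    R = ∑[ y ∈ xs ] g x y
    P = ∑ (pairs xs) (uncurry g)
    D = ∑[ y ∈ xs ] g y y
    regroup : ∀ a r p d → 2 * (r + p) + (a + d) ≡ a + r + (r + (2 * p + d))
    regroup = solve-∀

module AdjacencySums (vs : List A) (adj : A → A → Bool) where

  adjSum : (A → A → ℕ) → ℕ
  adjSum h = ∑[ u ∈ vs ] ∑[ v ∈ vs ] χ (adj u v) * h u v

  deg-∑ : ∀ u → deg vs adj u ≡ ∑[ v ∈ vs ] χ (adj u v)
  deg-∑ u = trans (length≡∑-1 (filterᵇ (adj u) vs))
                  (trans (∑-filterᵇ (adj u) vs (λ _ → 1)) (∑-cong vs (λ v → *-identityʳ (χ (adj u v)))))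

  adjSum-linear : (a b c : ℕ) (f g h : A → A → ℕ) →
                  adjSum (λ u v → a * f u v + b * g u v + c * h u v) ≡ a * adjSum f + b * adjSum g + c * adjSum h
  adjSum-linear a b c f g h = begin
    ∑[ u ∈ vs ] ∑[ v ∈ vs ] χ (adj u v) * (a * f u v + b * g u v + c * h u v)
      ≡⟨ ∑-cong vs (λ u → trans (∑-cong vs (λ v → distribute (χ (adj u v)) a b c (f u v) (g u v) (h u v)))
                                (∑-linear vs a b c (λ v → χ (adj u v) * f u v) (λ v → χ (adj u v) * g u v)
                                                   (λ v → χ (adj u v) * h u v))) ⟩
    ∑[ u ∈ vs ] (a * (∑[ v ∈ vs ] χ (adj u v) * f u v) + b * (∑[ v ∈ vs ] χ (adj u v) * g u v)
                 + c * (∑[ v ∈ vs ] χ (adj u v) * h u v))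
      ≡⟨ ∑-linear vs a b c _ _ _ ⟩
    a * adjSum f + b * adjSum g + c * adjSum h ∎
    where
      open ≡-Reasoning
      distribute : ∀ i a b c x y z → i * (a * x + b * y + c * z) ≡ a * (i * x) + b * (i * y) + c * (i * z)
      distribute = solve-∀

  adjSum-left : (f : A → ℕ) → adjSum (λ u _ → f u) ≡ ∑[ u ∈ vs ] deg vs adj u * f u
  adjSum-left f = ∑-cong vs (λ u → sym (trans (cong (_* f u) (deg-∑ u)) (*-distribʳ-∑ (f u) vs (λ v → χ (adj u v)))))

  module _ (adj-sym : ∀ u v → adj u v ≡ adj v u) (adj-irrefl : ∀ u → adj u u ≡ false) where

    adjSum-right : (f : A → ℕ) → adjSum (λ _ v → f v) ≡ ∑[ u ∈ vs ] deg vs adj u * f u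
    adjSum-right f = trans (∑-comm vs vs (λ u v → χ (adj u v) * f v))
                           (trans (∑-cong vs (λ v → ∑-cong vs (λ u → cong (λ b → χ b * f v) (adj-sym u v))))
                                  (adjSum-left f))

    ∑-edges-double : (h : A → A → ℕ) → (∀ u v → h u v ≡ h v u) → 2 * ∑ (edges vs adj) (uncurry h) ≡ adjSum h
    ∑-edges-double h h-sym = begin
      2 * ∑ (edges vs adj) (uncurry h)
        ≡⟨ cong (2 *_) (∑-filterᵇ _ (pairs vs) (uncurry h)) ⟩
      2 * ∑ (pairs vs) (uncurry h′)
        ≡⟨ sym (+-identityʳ _) ⟩
      2 * ∑ (pairs vs) (uncurry h′) + 0
        ≡⟨ cong (2 * ∑ (pairs vs) (uncurry h′) +_) (sym diagonal-vanishes) ⟩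
      2 * ∑ (pairs vs) (uncurry h′) + (∑[ u ∈ vs ] h′ u u)
        ≡⟨ ∑-pairs vs h′ h′-sym ⟩
      adjSum h ∎
      where
        open ≡-Reasoning
        h′ : A → A → ℕ
        h′ u v = χ (adj u v) * h u v
        h′-sym : ∀ u v → h′ u v ≡ h′ v u
        h′-sym u v = cong₂ (λ b x → χ b * x) (adj-sym u v) (h-sym u v)
        diagonal-vanishes : ∑[ u ∈ vs ] h′ u u ≡ 0
        diagonal-vanishes = trans (∑-cong vs (λ u → cong (λ b → χ b * h u u) (adj-irrefl u))) (∑-zero vs)

    HM-double : 2 * HM vs adj ≡ adjSum (λ u v → (deg vs adj u + deg vs adj v) ^ 2)
    HM-double = ∑-edges-double (λ u v → (deg vs adj u + deg vs adj v) ^ 2)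
                               (λ u v → cong (_^ 2) (+-comm (deg vs adj u) (deg vs adj v)))

    adjSum-1 : adjSum (λ _ _ → 1) ≡ 2 * numEdges vs adj
    adjSum-1 = sym (trans (cong (2 *_) (length≡∑-1 (edges vs adj))) (∑-edges-double (λ _ _ → 1) (λ _ _ → refl)))

    handshake : ∑[ u ∈ vs ] deg vs adj u ≡ 2 * numEdges vs adj
    handshake = trans (∑-cong vs (λ u → trans (deg-∑ u) (∑-cong vs (λ v → sym (*-identityʳ (χ (adj u v)))))))
                      adjSum-1

    adjSum-deg-+ : adjSum (λ u v → deg vs adj u + deg vs adj v) ≡ 2 * M1 vs adj
    adjSum-deg-+ = begin
      adjSum (λ u v → deg vs adj u + deg vs adj v)
        ≡⟨ trans (∑-cong vs (λ u → trans (∑-cong vs (λ v → *-distribˡ-+ (χ (adj u v)) _ _)) (∑-distrib-+ vs _ _)))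
                 (∑-distrib-+ vs _ _) ⟩
      adjSum (λ u _ → deg vs adj u) + adjSum (λ _ v → deg vs adj v)
        ≡⟨ cong₂ _+_ (adjSum-left (deg vs adj)) (adjSum-right (deg vs adj)) ⟩
      S + S
        ≡⟨ cong (λ s → s + s) (∑-cong vs (λ u → cong (deg vs adj u *_) (sym (*-identityʳ (deg vs adj u))))) ⟩
      M1 vs adj + M1 vs adj
        ≡⟨ cong (M1 vs adj +_) (sym (+-identityʳ (M1 vs adj))) ⟩
      2 * M1 vs adj ∎
      where
        open ≡-Reasoning
        S = ∑[ u ∈ vs ] deg vs adj u * deg vs adj u

∑-toℕ≟ : ∀ m c → ∑[ k ∈ allFin m ] χ ⌊ toℕ k ℕ.≟ c ⌋ ≡ χ ⌊ c <? m ⌋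
∑-toℕ≟ zero    c       = refl
∑-toℕ≟ (suc m) zero    = trans (∑-allFin-suc m (λ k → χ ⌊ toℕ k ℕ.≟ zero ⌋)) (cong suc (∑-zero (allFin m)))
∑-toℕ≟ (suc m) (suc c) = begin
  ∑[ k ∈ allFin (suc m) ] χ ⌊ toℕ k ℕ.≟ suc c ⌋
    ≡⟨ ∑-allFin-suc m (λ k → χ ⌊ toℕ k ℕ.≟ suc c ⌋) ⟩
  ∑[ k ∈ allFin m ] χ ⌊ suc (toℕ k) ℕ.≟ suc c ⌋
    ≡⟨ ∑-cong (allFin m) (λ k → cong χ (⌊⌋-via-does (suc (toℕ k) ℕ.≟ suc c) (toℕ k ℕ.≟ c) refl)) ⟩
  ∑[ k ∈ allFin m ] χ ⌊ toℕ k ℕ.≟ c ⌋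
    ≡⟨ ∑-toℕ≟ m c ⟩
  χ ⌊ c <? m ⌋
    ≡⟨ cong χ (⌊⌋-via-does (c <? m) (suc c <? suc m) refl) ⟩
  χ ⌊ suc c <? suc m ⌋ ∎
  where open ≡-Reasoning

χ-≟-+-χ-<? : ∀ {c s} → c ≤ s → χ ⌊ c ℕ.≟ s ⌋ + χ ⌊ c <? s ⌋ ≡ 1
χ-≟-+-χ-<? {c} {s} c≤s with m≤n⇒m<n∨m≡n c≤s
... | inj₁ c<s  = cong₂ (λ p q → χ p + χ q) (⌊⌋-no (c ℕ.≟ s) (<⇒≢ c<s)) (⌊⌋-yes (c <? s) c<s)
... | inj₂ refl = cong₂ (λ p q → χ p + χ q) (⌊⌋-yes (c ℕ.≟ c) refl) (⌊⌋-no (c <? c) (n≮n c))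

χ-∨-≟-suc : ∀ x y → χ (⌊ x ℕ.≟ suc y ⌋ ∨ ⌊ y ℕ.≟ suc x ⌋) ≡ χ ⌊ x ℕ.≟ suc y ⌋ + χ ⌊ y ℕ.≟ suc x ⌋
χ-∨-≟-suc x y with x ℕ.≟ suc y
... | no  _    = refl
... | yes refl = cong (λ b → suc (χ b)) (sym (⌊⌋-no (y ℕ.≟ suc (suc y)) (<⇒≢ (n≤1+n (suc y)))))

-- The r − 1 non-base vertices of an attached cycle form a path; this is its adjacency in `adjC`.
pathAdj : ∀ {m} → Fin m → Fin m → Bool
pathAdj k k′ = ⌊ toℕ k′ ℕ.≟ suc (toℕ k) ⌋ ∨ ⌊ toℕ k ℕ.≟ suc (toℕ k′) ⌋

pathDegree : ∀ {m} → Fin m → ℕ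
pathDegree {m} k = ∑[ k′ ∈ allFin m ] χ (pathAdj k k′)

∑-≟-suc-toℕ : ∀ m i → i ≤ m → ∑[ k ∈ allFin m ] χ ⌊ i ℕ.≟ suc (toℕ k) ⌋ ≡ χ ⌊ 0 <? i ⌋
∑-≟-suc-toℕ m zero    _   = ∑-zero (allFin m)
∑-≟-suc-toℕ m (suc c) c<m = begin
  ∑[ k ∈ allFin m ] χ ⌊ suc c ℕ.≟ suc (toℕ k) ⌋
    ≡⟨ ∑-cong (allFin m) (λ k → cong χ (trans (⌊⌋-via-does (suc c ℕ.≟ suc (toℕ k)) (c ℕ.≟ toℕ k) refl)
                                              (≟-sym ℕ._≟_ c (toℕ k)))) ⟩
  ∑[ k ∈ allFin m ] χ ⌊ toℕ k ℕ.≟ c ⌋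
    ≡⟨ trans (∑-toℕ≟ m c) (cong χ (⌊⌋-yes (c <? m) c<m)) ⟩
  1 ∎
  where open ≡-Reasoning

pathDegree-toℕ : ∀ {m} (k : Fin m) → pathDegree k ≡ χ ⌊ suc (toℕ k) <? m ⌋ + χ ⌊ 0 <? toℕ k ⌋
pathDegree-toℕ {m} k = begin
  ∑[ k′ ∈ allFin m ] χ (pathAdj k k′)
    ≡⟨ ∑-cong (allFin m) (λ k′ → χ-∨-≟-suc (toℕ k′) (toℕ k)) ⟩
  ∑[ k′ ∈ allFin m ] (χ ⌊ toℕ k′ ℕ.≟ suc (toℕ k) ⌋ + χ ⌊ toℕ k ℕ.≟ suc (toℕ k′) ⌋)
    ≡⟨ ∑-distrib-+ (allFin m) (λ k′ → χ ⌊ toℕ k′ ℕ.≟ suc (toℕ k) ⌋) (λ k′ → χ ⌊ toℕ k ℕ.≟ suc (toℕ k′) ⌋) ⟩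
  (∑[ k′ ∈ allFin m ] χ ⌊ toℕ k′ ℕ.≟ suc (toℕ k) ⌋)
    + (∑[ k′ ∈ allFin m ] χ ⌊ toℕ k ℕ.≟ suc (toℕ k′) ⌋)
    ≡⟨ cong₂ _+_ (∑-toℕ≟ m (suc (toℕ k))) (∑-≟-suc-toℕ m (toℕ k) (<⇒≤ (toℕ<n k))) ⟩
  χ ⌊ suc (toℕ k) <? m ⌋ + χ ⌊ 0 <? toℕ k ⌋ ∎
  where open ≡-Reasoning

∑-endIdx : ∀ s → ∑[ k ∈ allFin (2 + s) ] χ (endIdx (3 + s) k) ≡ 2
∑-endIdx s = begin
  ∑[ k ∈ allFin (2 + s) ] χ (endIdx (3 + s) k)
    ≡⟨ ∑-allFin-suc (suc s) (λ k → χ (endIdx (3 + s) k)) ⟩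
  1 + (∑[ k ∈ allFin (suc s) ] χ ⌊ suc (toℕ k) ℕ.≟ suc s ⌋)
    ≡⟨ cong suc (∑-cong (allFin (suc s)) (λ k → cong χ (⌊⌋-via-does (suc (toℕ k) ℕ.≟ suc s) (toℕ k ℕ.≟ s) refl))) ⟩
  1 + (∑[ k ∈ allFin (suc s) ] χ ⌊ toℕ k ℕ.≟ s ⌋)
    ≡⟨ cong suc (trans (∑-toℕ≟ (suc s) s) (cong χ (⌊⌋-yes (s <? suc s) (n<1+n s)))) ⟩
  2 ∎
  where open ≡-Reasoning

endIdx-+-pathDegree : ∀ s (k : Fin (2 + s)) → χ (endIdx (3 + s) k) + pathDegree k ≡ 2
endIdx-+-pathDegree s k =
  trans (cong (χ (endIdx (3 + s) k) +_) (pathDegree-toℕ k)) (by-position (toℕ k) (toℕ<n k))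
  where
    by-position : ∀ i → i < 2 + s →
                  χ (⌊ i ℕ.≟ 0 ⌋ ∨ ⌊ i ℕ.≟ suc s ⌋) + (χ ⌊ suc i <? 2 + s ⌋ + χ ⌊ 0 <? i ⌋) ≡ 2
    by-position zero    _           = refl
    by-position (suc c) (s≤s c<1+s) = begin
      χ ⌊ suc c ℕ.≟ suc s ⌋ + (χ ⌊ suc (suc c) <? 2 + s ⌋ + 1)
        ≡⟨ cong₂ (λ p q → χ p + (χ q + 1))
                 (⌊⌋-via-does (suc c ℕ.≟ suc s) (c ℕ.≟ s) refl) (⌊⌋-via-does (suc (suc c) <? 2 + s) (c <? s) refl) ⟩
      χ ⌊ c ℕ.≟ s ⌋ + (χ ⌊ c <? s ⌋ + 1)
        ≡⟨ trans (sym (+-assoc (χ ⌊ c ℕ.≟ s ⌋) _ 1)) (cong (_+ 1) (χ-≟-+-χ-<? (≤-pred c<1+s))) ⟩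
      2 ∎
      where open ≡-Reasoning

∑-pathDegree : ∀ s → ∑[ k ∈ allFin (2 + s) ] pathDegree k ≡ 2 * (1 + s)
∑-pathDegree s = +-cancelˡ-≡ 2 _ _ (begin
  2 + (∑[ k ∈ allFin (2 + s) ] pathDegree k)
    ≡⟨ cong (_+ ∑ (allFin (2 + s)) pathDegree) (sym (∑-endIdx s)) ⟩
  (∑[ k ∈ allFin (2 + s) ] χ (endIdx (3 + s) k)) + (∑[ k ∈ allFin (2 + s) ] pathDegree k)
    ≡⟨ sym (∑-distrib-+ (allFin (2 + s)) (λ k → χ (endIdx (3 + s) k)) pathDegree) ⟩
  ∑[ k ∈ allFin (2 + s) ] (χ (endIdx (3 + s) k) + pathDegree k)
    ≡⟨ trans (∑-cong (allFin (2 + s)) (endIdx-+-pathDegree s)) (∑-allFin-const (2 + s) 2) ⟩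
  (2 + s) * 2
    ≡⟨ cong (2 +_) (*-comm (1 + s) 2) ⟩
  2 + 2 * (1 + s) ∎)
  where open ≡-Reasoning

module AttachedCycles {n : ℕ} (adj : Adj n) (t r : ℕ) where

  vsᶜ : List (VC n t r)
  vsᶜ = vsC n t r

  adjᶜ : VC n t r → VC n t r → Bool
  adjᶜ = adjC adj t r

  adjC-sym : Symmetric adj → ∀ x y → adjᶜ x y ≡ adjᶜ y x
  adjC-sym adj-sym (inj₁ a) (inj₁ b) = adj-sym a b
  adjC-sym adj-sym (inj₁ a) (inj₂ y) = refl
  adjC-sym adj-sym (inj₂ x) (inj₁ b) = refl
  adjC-sym adj-sym (inj₂ (a , j , k)) (inj₂ (b , j′ , k′)) =
    cong₂ _∧_ (≟-sym Fin._≟_ a b) (cong₂ _∧_ (≟-sym Fin._≟_ j j′) (∨-comm (⌊ toℕ k′ ℕ.≟ suc (toℕ k) ⌋) _))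

  adjC-irrefl : Irreflexive adj → ∀ x → adjᶜ x x ≡ false
  adjC-irrefl adj-irrefl (inj₁ a) = adj-irrefl a
  adjC-irrefl adj-irrefl (inj₂ (a , j , k)) =
    trans (cong (λ b → ⌊ a Fin.≟ a ⌋ ∧ ⌊ j Fin.≟ j ⌋ ∧ (b ∨ b)) (⌊⌋-no (toℕ k ℕ.≟ suc (toℕ k)) (1+n≢n ∘ sym)))
          (trans (cong (⌊ a Fin.≟ a ⌋ ∧_) (∧-zeroʳ _)) (∧-zeroʳ _))

  ∑-vsC : (f : VC n t r → ℕ) →
          ∑ vsᶜ f ≡ (∑[ a ∈ allFin n ] f (inj₁ a))
                    + (∑[ a ∈ allFin n ] ∑[ j ∈ allFin t ] ∑[ k ∈ allFin (r ∸ 1) ] f (inj₂ (a , j , k)))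
  ∑-vsC f =
    trans (∑-++ (map inj₁ (allFin n)) (map inj₂ cycleVertices) f)
          (cong₂ _+_ (∑-map inj₁ (allFin n) f)
                     (trans (∑-map inj₂ cycleVertices f)
                            (trans (∑-cartesianProduct (allFin n) _ (f ∘ inj₂))
                                   (∑-cong (allFin n) (λ a → ∑-cartesianProduct (allFin t) (allFin (r ∸ 1)) _)))))
    where
      cycleVertices = cartesianProduct (allFin n) (cartesianProduct (allFin t) (allFin (r ∸ 1)))

  ∑-neighbours-base : (a : Fin n) (g : VC n t r → ℕ) →
                ∑[ y ∈ vsᶜ ] χ (adjᶜ (inj₁ a) y) * g y
                ≡ (∑[ b ∈ allFin n ] χ (adj a b) * g (inj₁ b))
                  + (∑[ j ∈ allFin t ] ∑[ k ∈ allFin (r ∸ 1) ] χ (endIdx r k) * g (inj₂ (a , j , k)))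
  ∑-neighbours-base a g =
    trans (∑-vsC (λ y → χ (adjᶜ (inj₁ a) y) * g y)) (cong ((∑[ b ∈ allFin n ] χ (adj a b) * g (inj₁ b)) +_) (begin
    ∑[ b ∈ allFin n ] ∑[ j ∈ allFin t ] ∑[ k ∈ allFin (r ∸ 1) ] χ (⌊ a Fin.≟ b ⌋ ∧ endIdx r k) * g (inj₂ (b , j , k))
      ≡⟨ ∑-cong (allFin n) (λ b → ∑-cong (allFin t) (λ j → ∑-χ-∧ ⌊ a Fin.≟ b ⌋ (allFin (r ∸ 1)) (endIdx r) _)) ⟩
    ∑[ b ∈ allFin n ] ∑[ j ∈ allFin t ] χ ⌊ a Fin.≟ b ⌋ * (∑[ k ∈ allFin (r ∸ 1) ] χ (endIdx r k) * g (inj₂ (b , j , k)))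
      ≡⟨ ∑-δ-outer a (allFin t) _ ⟩
    ∑[ j ∈ allFin t ] ∑[ k ∈ allFin (r ∸ 1) ] χ (endIdx r k) * g (inj₂ (a , j , k)) ∎))
    where open ≡-Reasoning

  ∑-neighbours-cycle : (a : Fin n) (j : Fin t) (k : Fin (r ∸ 1)) (g : VC n t r → ℕ) →
                 ∑[ y ∈ vsᶜ ] χ (adjᶜ (inj₂ (a , j , k)) y) * g y
                 ≡ χ (endIdx r k) * g (inj₁ a) + (∑[ k′ ∈ allFin (r ∸ 1) ] χ (pathAdj k k′) * g (inj₂ (a , j , k′)))
  ∑-neighbours-cycle a j k g = trans (∑-vsC (λ y → χ (adjᶜ (inj₂ (a , j , k)) y) * g y)) (cong₂ _+_ (begin
    ∑[ b ∈ allFin n ] χ (⌊ b Fin.≟ a ⌋ ∧ endIdx r k) * g (inj₁ b)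
      ≡⟨ ∑-cong (allFin n) (λ b → trans (χ-∧ ⌊ b Fin.≟ a ⌋ (endIdx r k) (g (inj₁ b)))
                                        (cong (λ e → χ e * (χ (endIdx r k) * g (inj₁ b))) (≟-sym Fin._≟_ b a))) ⟩
    ∑[ b ∈ allFin n ] χ ⌊ a Fin.≟ b ⌋ * (χ (endIdx r k) * g (inj₁ b))
      ≡⟨ ∑-δ a (λ b → χ (endIdx r k) * g (inj₁ b)) ⟩
    χ (endIdx r k) * g (inj₁ a) ∎) (begin
    ∑[ b ∈ allFin n ] ∑[ j′ ∈ allFin t ] ∑[ k′ ∈ allFin (r ∸ 1) ]
      χ (⌊ a Fin.≟ b ⌋ ∧ ⌊ j Fin.≟ j′ ⌋ ∧ pathAdj k k′) * g (inj₂ (b , j′ , k′))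
      ≡⟨ ∑-cong (allFin n) (λ b → ∑-cong (allFin t) (λ j′ →
           ∑-χ-∧ ⌊ a Fin.≟ b ⌋ (allFin (r ∸ 1)) (λ k′ → ⌊ j Fin.≟ j′ ⌋ ∧ pathAdj k k′) _)) ⟩
    ∑[ b ∈ allFin n ] ∑[ j′ ∈ allFin t ]
      χ ⌊ a Fin.≟ b ⌋ * (∑[ k′ ∈ allFin (r ∸ 1) ] χ (⌊ j Fin.≟ j′ ⌋ ∧ pathAdj k k′) * g (inj₂ (b , j′ , k′)))
      ≡⟨ ∑-δ-outer a (allFin t) _ ⟩
    ∑[ j′ ∈ allFin t ] ∑[ k′ ∈ allFin (r ∸ 1) ] χ (⌊ j Fin.≟ j′ ⌋ ∧ pathAdj k k′) * g (inj₂ (a , j′ , k′))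
      ≡⟨ ∑-cong (allFin t) (λ j′ → ∑-χ-∧ ⌊ j Fin.≟ j′ ⌋ (allFin (r ∸ 1)) (pathAdj k) _) ⟩
    ∑[ j′ ∈ allFin t ] χ ⌊ j Fin.≟ j′ ⌋ * (∑[ k′ ∈ allFin (r ∸ 1) ] χ (pathAdj k k′) * g (inj₂ (a , j′ , k′)))
      ≡⟨ ∑-δ j (λ j′ → ∑[ k′ ∈ allFin (r ∸ 1) ] χ (pathAdj k k′) * g (inj₂ (a , j′ , k′))) ⟩
    ∑[ k′ ∈ allFin (r ∸ 1) ] χ (pathAdj k k′) * g (inj₂ (a , j , k′)) ∎))
    where open ≡-Reasoning

∑-endIdx-* : ∀ s c → ∑[ k ∈ allFin (2 + s) ] χ (endIdx (3 + s) k) * c ≡ 2 * c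
∑-endIdx-* s c = trans (sym (*-distribʳ-∑ c (allFin (2 + s)) (λ k → χ (endIdx (3 + s) k)))) (cong (_* c) (∑-endIdx s))

-- `Data.Nat.Tactic.RingSolver` does not handle `_^_`, hence the non-reflective solver below.
square-shifted : ∀ x y t → (x + t * 2 + (y + t * 2)) ^ 2 ≡ 1 * (x + y) ^ 2 + 8 * t * (x + y) + 16 * t * t * 1
square-shifted = solve 3 (λ x y t → (x :+ t :* con 2 :+ (y :+ t :* con 2)) :^ 2
                                    := con 1 :* (x :+ y) :^ 2 :+ con 8 :* t :* (x :+ y) :+ con 16 :* t :* t :* con 1) refl

cycle-contribution : ∀ x t s → t * (2 * (x + t * 2 + 2) ^ 2) + t * (2 * (x + t * 2 + 2) ^ 2 + 2 * (1 + s) * 16)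
                               ≡ 4 * t * x ^ 2 + 8 * t * (2 * t + 2) * x + (4 * t * (2 * t + 2) ^ 2 + 32 * t * (1 + s)) * 1
cycle-contribution = solve 3 (λ x t s → t :* (con 2 :* (x :+ t :* con 2 :+ con 2) :^ 2)
                                        :+ t :* (con 2 :* (x :+ t :* con 2 :+ con 2) :^ 2 :+ con 2 :* (con 1 :+ s) :* con 16)
                                        := con 4 :* t :* x :^ 2 :+ con 8 :* t :* (con 2 :* t :+ con 2) :* x
                                           :+ (con 4 :* t :* (con 2 :* t :+ con 2) :^ 2 :+ con 32 :* t :* (con 1 :+ s)) :* con 1) refl

module HyperZagrebAttached {n : ℕ} (adj : Adj n) (adj-sym : Symmetric adj) (adj-irrefl : Irreflexive adj) (t s : ℕ) where

  open AttachedCycles adj t (3 + s)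
  module G  = AdjacencySums (allFin n) adj
  module Gᶜ = AdjacencySums vsᶜ adjᶜ

  d : Fin n → ℕ
  d = deg (allFin n) adj

  D : VC n t (3 + s) → ℕ
  D (inj₁ a) = d a + t * 2
  D (inj₂ _) = 2

  Q : Fin n → ℕ
  Q a = (d a + t * 2 + 2) ^ 2

  deg-attached : ∀ x → deg vsᶜ adjᶜ x ≡ D x
  deg-attached x = trans (Gᶜ.deg-∑ x) (trans (∑-cong vsᶜ (λ y → sym (*-identityʳ (χ (adjᶜ x y))))) (row-count x))
    where
      row-count : ∀ x → ∑[ y ∈ vsᶜ ] χ (adjᶜ x y) * 1 ≡ D x
      row-count (inj₁ a) = trans (∑-neighbours-base a (λ _ → 1)) (cong₂ _+_
        (trans (∑-cong (allFin n) (λ b → *-identityʳ (χ (adj a b)))) (sym (G.deg-∑ a)))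
        (trans (∑-cong (allFin t) (λ j → ∑-endIdx-* s 1)) (∑-allFin-const t 2)))
      row-count (inj₂ (a , j , k)) = trans (∑-neighbours-cycle a j k (λ _ → 1)) (trans
        (cong₂ _+_ (*-identityʳ (χ (endIdx (3 + s) k))) (∑-cong (allFin (2 + s)) (λ k′ → *-identityʳ (χ (pathAdj k k′)))))
        (endIdx-+-pathDegree s k))

  base-row : ∀ a → ∑[ y ∈ vsᶜ ] χ (adjᶜ (inj₁ a) y) * (D (inj₁ a) + D y) ^ 2
                   ≡ (∑[ b ∈ allFin n ] χ (adj a b) * (D (inj₁ a) + D (inj₁ b)) ^ 2) + t * (2 * Q a)
  base-row a = trans (∑-neighbours-base a (λ y → (D (inj₁ a) + D y) ^ 2))
                     (cong (∑ (allFin n) (λ b → χ (adj a b) * (D (inj₁ a) + D (inj₁ b)) ^ 2) +_)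
                           (trans (∑-cong (allFin t) (λ j → ∑-endIdx-* s (Q a))) (∑-allFin-const t (2 * Q a))))

  cycle-rows : ∀ a → ∑[ j ∈ allFin t ] ∑[ k ∈ allFin (2 + s) ] ∑[ y ∈ vsᶜ ] χ (adjᶜ (inj₂ (a , j , k)) y) * (2 + D y) ^ 2
                     ≡ t * (2 * Q a + 2 * (1 + s) * 16)
  cycle-rows a = trans (∑-cong (allFin t) (λ j → begin
    ∑[ k ∈ allFin (2 + s) ] ∑[ y ∈ vsᶜ ] χ (adjᶜ (inj₂ (a , j , k)) y) * (2 + D y) ^ 2
      ≡⟨ ∑-cong (allFin (2 + s)) (λ k → ∑-neighbours-cycle a j k (λ y → (2 + D y) ^ 2)) ⟩
    ∑[ k ∈ allFin (2 + s) ] (χ (endIdx (3 + s) k) * (2 + D (inj₁ a)) ^ 2 + (∑[ k′ ∈ allFin (2 + s) ] χ (pathAdj k k′) * 16))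
      ≡⟨ ∑-cong (allFin (2 + s)) (λ k → cong₂ _+_ (cong (λ z → χ (endIdx (3 + s) k) * z ^ 2) (+-comm 2 (D (inj₁ a))))
                                                 (sym (*-distribʳ-∑ 16 (allFin (2 + s)) (λ k′ → χ (pathAdj k k′))))) ⟩
    ∑[ k ∈ allFin (2 + s) ] (χ (endIdx (3 + s) k) * Q a + pathDegree k * 16)
      ≡⟨ ∑-distrib-+ (allFin (2 + s)) (λ k → χ (endIdx (3 + s) k) * Q a) (λ k → pathDegree k * 16) ⟩
    (∑[ k ∈ allFin (2 + s) ] χ (endIdx (3 + s) k) * Q a) + (∑[ k ∈ allFin (2 + s) ] pathDegree k * 16)
      ≡⟨ cong₂ _+_ (∑-endIdx-* s (Q a)) (trans (sym (*-distribʳ-∑ 16 (allFin (2 + s)) pathDegree)) (cong (_* 16) (∑-pathDegree s))) ⟩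
    2 * Q a + 2 * (1 + s) * 16 ∎)) (∑-allFin-const t _)
    where open ≡-Reasoning

  twice-HM-attached : 2 * HM vsᶜ adjᶜ
                      ≡ G.adjSum (λ a b → (d a + t * 2 + (d b + t * 2)) ^ 2)
                        + (∑[ a ∈ allFin n ] (t * (2 * Q a) + t * (2 * Q a + 2 * (1 + s) * 16)))
  twice-HM-attached = begin
    2 * HM vsᶜ adjᶜ
      ≡⟨ Gᶜ.HM-double (adjC-sym adj-sym) (adjC-irrefl adj-irrefl) ⟩
    Gᶜ.adjSum (λ x y → (deg vsᶜ adjᶜ x + deg vsᶜ adjᶜ y) ^ 2)
      ≡⟨ ∑-cong vsᶜ (λ x → ∑-cong vsᶜ (λ y →
           cong₂ (λ p q → χ (adjᶜ x y) * (p + q) ^ 2) (deg-attached x) (deg-attached y))) ⟩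
    Gᶜ.adjSum (λ x y → (D x + D y) ^ 2)
      ≡⟨ ∑-vsC (λ x → ∑[ y ∈ vsᶜ ] χ (adjᶜ x y) * (D x + D y) ^ 2) ⟩
    (∑[ a ∈ allFin n ] ∑[ y ∈ vsᶜ ] χ (adjᶜ (inj₁ a) y) * (D (inj₁ a) + D y) ^ 2)
      + (∑[ a ∈ allFin n ] ∑[ j ∈ allFin t ] ∑[ k ∈ allFin (2 + s) ] ∑[ y ∈ vsᶜ ]
           χ (adjᶜ (inj₂ (a , j , k)) y) * (2 + D y) ^ 2)
      ≡⟨ cong₂ _+_ (trans (∑-cong (allFin n) base-row) (∑-distrib-+ (allFin n) _ _)) (∑-cong (allFin n) cycle-rows) ⟩
    X + (∑[ a ∈ allFin n ] t * (2 * Q a)) + (∑[ a ∈ allFin n ] t * (2 * Q a + 2 * (1 + s) * 16))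
      ≡⟨ trans (+-assoc X _ _) (cong (X +_) (sym (∑-distrib-+ (allFin n) _ _))) ⟩
    X + (∑[ a ∈ allFin n ] (t * (2 * Q a) + t * (2 * Q a + 2 * (1 + s) * 16))) ∎
    where
      open ≡-Reasoning
      X = G.adjSum (λ a b → (d a + t * 2 + (d b + t * 2)) ^ 2)

  contribution-of-G : G.adjSum (λ a b → (d a + t * 2 + (d b + t * 2)) ^ 2)
                   ≡ 1 * (2 * HM (allFin n) adj) + 8 * t * (2 * M1 (allFin n) adj) + 16 * t * t * (2 * numEdges (allFin n) adj)
  contribution-of-G = begin
    G.adjSum (λ a b → (d a + t * 2 + (d b + t * 2)) ^ 2)
      ≡⟨ ∑-cong (allFin n) (λ a → ∑-cong (allFin n) (λ b → cong (χ (adj a b) *_) (square-shifted (d a) (d b) t))) ⟩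
    G.adjSum (λ a b → 1 * (d a + d b) ^ 2 + 8 * t * (d a + d b) + 16 * t * t * 1)
      ≡⟨ G.adjSum-linear 1 (8 * t) (16 * t * t) _ _ _ ⟩
    1 * G.adjSum (λ a b → (d a + d b) ^ 2) + 8 * t * G.adjSum (λ a b → d a + d b) + 16 * t * t * G.adjSum (λ _ _ → 1)
      ≡⟨ cong₂ _+_ (cong₂ (λ h m → 1 * h + 8 * t * m) (sym (G.HM-double adj-sym adj-irrefl)) (G.adjSum-deg-+ adj-sym adj-irrefl))
                   (cong (16 * t * t *_) (G.adjSum-1 adj-sym adj-irrefl)) ⟩
    1 * (2 * HM (allFin n) adj) + 8 * t * (2 * M1 (allFin n) adj) + 16 * t * t * (2 * numEdges (allFin n) adj) ∎
    where open ≡-Reasoning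

  contribution-of-cycles : ∑[ a ∈ allFin n ] (t * (2 * Q a) + t * (2 * Q a + 2 * (1 + s) * 16))
                    ≡ 4 * t * M1 (allFin n) adj + 8 * t * (2 * t + 2) * (2 * numEdges (allFin n) adj)
                      + (4 * t * (2 * t + 2) ^ 2 + 32 * t * (1 + s)) * (n * 1)
  contribution-of-cycles = begin
    ∑[ a ∈ allFin n ] (t * (2 * Q a) + t * (2 * Q a + 2 * (1 + s) * 16))
      ≡⟨ ∑-cong (allFin n) (λ a → cycle-contribution (d a) t s) ⟩
    ∑[ a ∈ allFin n ] (4 * t * d a ^ 2 + 8 * t * (2 * t + 2) * d a + (4 * t * (2 * t + 2) ^ 2 + 32 * t * (1 + s)) * 1)
      ≡⟨ ∑-linear (allFin n) (4 * t) (8 * t * (2 * t + 2)) (4 * t * (2 * t + 2) ^ 2 + 32 * t * (1 + s)) _ d _ ⟩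
    4 * t * M1 (allFin n) adj + 8 * t * (2 * t + 2) * (∑[ a ∈ allFin n ] d a)
      + (4 * t * (2 * t + 2) ^ 2 + 32 * t * (1 + s)) * (∑[ a ∈ allFin n ] 1)
      ≡⟨ cong₂ (λ e m → 4 * t * M1 (allFin n) adj + 8 * t * (2 * t + 2) * e + (4 * t * (2 * t + 2) ^ 2 + 32 * t * (1 + s)) * m)
               (G.handshake adj-sym adj-irrefl) (∑-allFin-const n 1) ⟩
    4 * t * M1 (allFin n) adj + 8 * t * (2 * t + 2) * (2 * numEdges (allFin n) adj)
      + (4 * t * (2 * t + 2) ^ 2 + 32 * t * (1 + s)) * (n * 1) ∎
    where open ≡-Reasoning

zagreb-combination : ∀ H M E n t s →
  1 * (2 * H) + 8 * t * (2 * M) + 16 * t * t * (2 * E)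
    + (4 * t * M + 8 * t * (2 * t + 2) * (2 * E) + (4 * t * (2 * t + 2) ^ 2 + 32 * t * (1 + s)) * (n * 1))
  ≡ 2 * (H + 10 * t * M + 32 * E * t ^ 2 + 16 * E * t + 8 * n * t ^ 3 + 16 * n * t ^ 2 + (24 + 16 * s) * n * t)
zagreb-combination = solve 6 (λ H M E n t s →
  con 1 :* (con 2 :* H) :+ con 8 :* t :* (con 2 :* M) :+ con 16 :* t :* t :* (con 2 :* E)
    :+ (con 4 :* t :* M :+ con 8 :* t :* (con 2 :* t :+ con 2) :* (con 2 :* E)
        :+ (con 4 :* t :* (con 2 :* t :+ con 2) :^ 2 :+ con 32 :* t :* (con 1 :+ s)) :* (n :* con 1))
  := con 2 :* (H :+ con 10 :* t :* M :+ con 32 :* E :* t :^ 2 :+ con 16 :* E :* t :+ con 8 :* n :* t :^ 3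
               :+ con 16 :* n :* t :^ 2 :+ (con 24 :+ con 16 :* s) :* n :* t)) refl

16*[3+s]∸24 : ∀ s → 16 * (3 + s) ∸ 24 ≡ 24 + 16 * s
16*[3+s]∸24 s = trans (cong (_∸ 24) (split s)) (m+n∸n≡m (24 + 16 * s) 24)
  where
    split : ∀ s → 16 * (3 + s) ≡ 24 + 16 * s + 24
    split = solve 1 (λ s → con 16 :* (con 3 :+ s) := con 24 :+ con 16 :* s :+ con 24) refl

mainTheorem3 : (n : ℕ) (adj : Adj n) → Symmetric adj → Irreflexive adj → Connected adj →
    (t r : ℕ) → 3 ≤ r →
    HM (vsC n t r) (adjC adj t r)
      ≡ HM (allFin n) adj + 10 * t * M1 (allFin n) adj
        + 32 * numEdges (allFin n) adj * t ^ 2 + 16 * numEdges (allFin n) adj * t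
        + 8 * n * t ^ 3 + 16 * n * t ^ 2 + (16 * r ∸ 24) * n * t
mainTheorem3 n adj adj-sym adj-irrefl _ t (suc (suc (suc s))) (s≤s (s≤s (s≤s _))) = *-cancelˡ-≡ _ _ 2 (begin
  2 * HM (vsC n t (3 + s)) (adjC adj t (3 + s))
    ≡⟨ twice-HM-attached ⟩
  G.adjSum (λ a b → (d a + t * 2 + (d b + t * 2)) ^ 2)
    + (∑[ a ∈ allFin n ] (t * (2 * Q a) + t * (2 * Q a + 2 * (1 + s) * 16)))
    ≡⟨ cong₂ _+_ contribution-of-G contribution-of-cycles ⟩
  1 * (2 * H) + 8 * t * (2 * M) + 16 * t * t * (2 * m)
    + (4 * t * M + 8 * t * (2 * t + 2) * (2 * m) + (4 * t * (2 * t + 2) ^ 2 + 32 * t * (1 + s)) * (n * 1))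
    ≡⟨ zagreb-combination H M m n t s ⟩
  2 * rhs (24 + 16 * s)
    ≡⟨ cong (λ c → 2 * rhs c) (sym (16*[3+s]∸24 s)) ⟩
  2 * rhs (16 * (3 + s) ∸ 24) ∎)
  where
    open ≡-Reasoning
    open HyperZagrebAttached adj adj-sym adj-irrefl t s
    H M m : ℕ
    H = HM (allFin n) adj
    M = M1 (allFin n) adj
    m = numEdges (allFin n) adj
    rhs : ℕ → ℕ
    rhs c = H + 10 * t * M + 32 * m * t ^ 2 + 16 * m * t + 8 * n * t ^ 3 + 16 * n * t ^ 2 + c * n * t
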